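{- Let $\Gamma$ be a finite thick linear space with point set $\mathcal P$ and line set $\mathcal L$ such that the triangle complex $\Delta(\Gamma)$ is flag-transitive, and let $\phi\in\mathrm{Aut}(\Delta(\Gamma))$. Define $F_\phi$ on $\mathcal P\sqcup\mathcal L$ by $F_\phi(p)=\pi_1(\phi((p,L,1)))$ for any line $L$ incident with $p$, and $F_\phi(L)=\pi_2(\phi((p,L,1)))$ for any point $p$ incident with $L$ (these values do not depend on the choices of $L$ and $p$). Then $F_\phi$ is an automorphism of $\Gamma$, and for all incident $p\in\mathcal P$, $L\in\mathcal L$ and all $i\in\{1,2,3\}$ we have $\phi((p,L,i))=(F_\phi(p),F_\phi(L),i)$.
   Context: A linear space is a rank two geometry of points and lines in which every line has at least two points, every point is on at least two lines, and any two distinct points lie on exactly one common line; it is thick if every line has at least three points and every point is on at least three lines. Triangle complex: $\Delta(\Gamma)$ is the rank three incidence system over $\{1,2,3\}$ whose elements are the triples $(p,L,i)$ with $p$ incident with $L$ and $i\in\{1,2,3\}$; the type of $(p,L,i)$ is $i$; and $(p,L,i)$ is incident with $(p',L',i \bmod 3+1)$ if and only if the set of points incident with both $L$ and $L'$ is exactly $\{p\}$ and $p\neq p'$ (incidence symmetric and reflexive, no other incidences). An automorphism is a type-preserving bijection preserving incidence; $\Delta(\Gamma)$ is flag-transitive if its automorphism group is transitive on chambers (sets of three pairwise incident elements of types $1,2,3$). The projections are $\pi_1((p,L,i))=p$ and $\pi_2((p,L,i))=L$. -}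

module Defs where

open import Data.Nat using (ℕ)
open import Data.Fin using (Fin; zero; suc)
open import Data.Bool using (Bool; T)
open import Data.Product using (Σ; ∃; ∃-syntax; _×_; _,_)
open import Data.Sum using (_⊎_)
open import Relation.Binary.PropositionalEquality using (_≡_; _≢_)
open import Relation.Nullary using (¬_)
open import Function.Bundles using (_⇔_)
open import Function.Definitions using (Bijective)

record Geometry : Set where
  field
    nP nL : ℕ
    inc   : Fin nP → Fin nL → Bool

module _ (Γ : Geometry) where
  open Geometry Γ

  Point = Fin nP
  Line  = Fin nL

  I : Point → Line → Set
  I p L = T (inc p L)

  ThreePoints : Line → Set
  ThreePoints L = ∃[ a ] ∃[ b ] ∃[ c ] (a ≢ b × b ≢ c × a ≢ c × I a L × I b L × I c L)

  ThreeLines : Point → Set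
  ThreeLines p = ∃[ A ] ∃[ B ] ∃[ C ] (A ≢ B × B ≢ C × A ≢ C × I p A × I p B × I p C)

  TwoPoints : Line → Set
  TwoPoints L = ∃[ a ] ∃[ b ] (a ≢ b × I a L × I b L)

  TwoLines : Point → Set
  TwoLines p = ∃[ A ] ∃[ B ] (A ≢ B × I p A × I p B)

  record IsLinearSpace : Set where
    field
      lineTwo  : ∀ L → TwoPoints L
      pointTwo : ∀ p → TwoLines p
      join     : ∀ p q → p ≢ q → ∃[ L ] (I p L × I q L)
      joinUniq : ∀ p q L L' → p ≢ q → I p L → I q L → I p L' → I q L' → L ≡ L'

  record IsThick : Set where
    field
      lineThree  : ∀ L → ThreePoints L
      pointThree : ∀ p → ThreeLines p

  record IsAutomorphism (fP : Point → Point) (fL : Line → Line) : Set where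
    field
      bijP : Bijective _≡_ _≡_ fP
      bijL : Bijective _≡_ _≡_ fL
      pres : ∀ p L → I p L ⇔ I (fP p) (fL L)

  -- Triangle complex Δ(Γ); types {1,2,3} are represented by Fin 3
  -- (zero ↦ 1, suc zero ↦ 2, suc (suc zero) ↦ 3).

  next : Fin 3 → Fin 3
  next zero = suc zero
  next (suc zero) = suc (suc zero)
  next (suc (suc zero)) = zero

  record Elem : Set where
    constructor elem
    field
      pt  : Point
      ln  : Line
      isI : I pt ln
      ty  : Fin 3
  open Elem public

  MeetExactly : Line → Line → Point → Set
  MeetExactly L L' p = ∀ x → (I x L × I x L') ⇔ (x ≡ p)

  Adj : Elem → Elem → Set
  Adj x y = ty y ≡ next (ty x) × MeetExactly (ln x) (ln y) (pt x) × pt x ≢ pt y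

  -- incidence of Δ(Γ): reflexive symmetric closure of Adj
  _*_ : Elem → Elem → Set
  x * y = x ≡ y ⊎ Adj x y ⊎ Adj y x

  record IsΔAutomorphism (φ : Elem → Elem) : Set where
    field
      typePres : ∀ x → ty (φ x) ≡ ty x
      bij      : Bijective _≡_ _≡_ φ
      incPres  : ∀ x y → (x * y) ⇔ (φ x * φ y)

  record Chamber : Set where
    field
      c₁ c₂ c₃ : Elem
      t₁ : ty c₁ ≡ zero
      t₂ : ty c₂ ≡ suc zero
      t₃ : ty c₃ ≡ suc (suc zero)
      i₁₂ : c₁ * c₂
      i₂₃ : c₂ * c₃
      i₁₃ : c₁ * c₃
  open Chamber public

  FlagTransitive : Set
  FlagTransitive = ∀ (C D : Chamber) → ∃[ φ ] (IsΔAutomorphism φ ×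
    φ (c₁ C) ≡ c₁ D × φ (c₂ C) ≡ c₂ D × φ (c₃ C) ≡ c₃ D)

{-# OPTIONS --safe #-}
-- For elements x, y of Δ(Γ) with ty x = next (ty y), the point of x lies on the line of y
-- exactly when there is no path x → z → y of generating incidences: such a path forces
-- pt x ∉ ln y, and conversely, if p ∉ L', thickness gives a point q of L' off L and other than
-- the point of y, and the join of p and q is the line of a middle element z.  So φ preserves this
-- incidence between consecutive types.  As φ is onto the points and the lines of every type,
-- ln (φ y) is then determined by its points as a function of ln y, first for a fixed type and
-- then for consecutive types; dually pt (φ x) is a function of pt x.  These two functions are
-- F_φ on points and lines, and the mixed incidence shows that they form an automorphism of Γ.
module Submission where

open import Defs
open import Data.Fin using (Fin; zero; suc)
open import Data.Fin.Properties using (_≟_)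
open import Data.Bool.Properties using (T?)
open import Data.Product using (∃-syntax; _×_; _,_; proj₁; proj₂)
open import Data.Sum using (_⊎_; inj₁; inj₂)
open import Relation.Nullary using (¬_; Dec; yes; no)
open import Relation.Nullary.Decidable using (decidable-stable)
open import Relation.Nullary.Negation using (contradiction)
open import Relation.Binary.PropositionalEquality
  using (_≡_; _≢_; ≢-sym; refl; sym; trans; cong; subst; subst₂)
open import Function.Bundles using (_⇔_; Equivalence; mk⇔)
import Function.Properties.Equivalence as ⇔
open import Function.Related.TypeIsomorphisms using (¬-cong-⇔)
open import Function.Definitions using (Injective; StrictlySurjective)
open import Function.Consequences.Propositional using (strictlySurjective⇒surjective)

open Equivalence using (to; from)

module IncidenceProperties (Γ : Geometry) where

  I? : ∀ p L → Dec (I Γ p L)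
  I? p L = T? (Geometry.inc Γ p L)

  on-notOn⇒lines≢ : ∀ {p L L'} → I Γ p L → ¬ I Γ p L' → L ≢ L'
  on-notOn⇒lines≢ p∈L p∉L' refl = p∉L' p∈L

  notOn-on⇒points≢ : ∀ {p q L} → ¬ I Γ p L → I Γ q L → p ≢ q
  notOn-on⇒points≢ p∉L q∈L refl = p∉L q∈L

module LinearSpaceProperties (Γ : Geometry) (LS : IsLinearSpace Γ) where
  open IsLinearSpace LS
  open IncidenceProperties Γ

  ∃-lineThrough : ∀ p → ∃[ L ] I Γ p L
  ∃-lineThrough p = let (L , _ , _ , p∈L , _) = pointTwo p in L , p∈L

  ∃-pointOn : ∀ L → ∃[ p ] I Γ p L
  ∃-pointOn L = let (p , _ , _ , p∈L , _) = lineTwo L in p , p∈L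

  points⊆⇒line≡ : ∀ {L L'} → (∀ w → I Γ w L → I Γ w L') → L ≡ L'
  points⊆⇒line≡ {L} {L'} L⊆L' =
    let (a , b , a≢b , a∈L , b∈L) = lineTwo L
    in joinUniq a b L L' a≢b a∈L b∈L (L⊆L' a a∈L) (L⊆L' b b∈L)

  lines⊆⇒point≡ : ∀ {p p'} → (∀ M → I Γ p M → I Γ p' M) → p ≡ p'
  lines⊆⇒point≡ {p} {p'} p⊆p' with p ≟ p'
  ... | yes p≡p' = p≡p'
  ... | no p≢p' =
    let (A , B , A≢B , p∈A , p∈B) = pointTwo p
    in contradiction (joinUniq p p' A B p≢p' p∈A (p⊆p' A p∈A) p∈B (p⊆p' B p∈B)) A≢B

  distinctLines-meetExactly : ∀ {p L M} → I Γ p L → I Γ p M → L ≢ M →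
                              MeetExactly Γ L M p
  distinctLines-meetExactly {p} {L} {M} p∈L p∈M L≢M w = mk⇔ w≡p λ { refl → p∈L , p∈M }
    where
    w≡p : I Γ w L × I Γ w M → w ≡ p
    w≡p (w∈L , w∈M) with w ≟ p
    ... | yes w≡p = w≡p
    ... | no w≢p = contradiction (joinUniq w p L M w≢p w∈L p∈L w∈M p∈M) L≢M

  module _ (TH : IsThick Γ) where
    open IsThick TH

    ∃-twoPointsOn-≢ : ∀ L p → ∃[ q₁ ] ∃[ q₂ ] (q₁ ≢ q₂ × I Γ q₁ L × I Γ q₂ L × q₁ ≢ p × q₂ ≢ p)
    ∃-twoPointsOn-≢ L p with lineThree L
    ... | a , b , c , a≢b , b≢c , a≢c , a∈L , b∈L , c∈L with a ≟ p | b ≟ p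
    ... | yes refl | _ = b , c , b≢c , b∈L , c∈L , ≢-sym a≢b , ≢-sym a≢c
    ... | no a≢p | yes refl = a , c , a≢c , a∈L , c∈L , a≢p , ≢-sym b≢c
    ... | no a≢p | no b≢p = a , b , a≢b , a∈L , b∈L , a≢p , b≢p

    -- L' meets L in at most one point.
    ∃-pointOn-notOn-≢ : ∀ {L L'} → L ≢ L' → ∀ p' → ∃[ q ] (I Γ q L' × ¬ I Γ q L × q ≢ p')
    ∃-pointOn-notOn-≢ {L} {L'} L≢L' p'
      with ∃-twoPointsOn-≢ L' p'
    ... | q₁ , q₂ , q₁≢q₂ , q₁∈L' , q₂∈L' , q₁≢p' , q₂≢p'
      with I? q₁ L | I? q₂ L
    ... | no q₁∉L | _ = q₁ , q₁∈L' , q₁∉L , q₁≢p'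
    ... | yes _ | no q₂∉L = q₂ , q₂∈L' , q₂∉L , q₂≢p'
    ... | yes q₁∈L | yes q₂∈L =
      contradiction (joinUniq q₁ q₂ L L' q₁≢q₂ q₁∈L q₂∈L q₁∈L' q₂∈L') L≢L'

module TriangleComplex (Γ : Geometry) where
  open IncidenceProperties Γ

  next³ : ∀ t → next Γ (next Γ (next Γ t)) ≡ t
  next³ zero = refl
  next³ (suc zero) = refl
  next³ (suc (suc zero)) = refl

  next-≢ : ∀ t → next Γ t ≢ t
  next-≢ zero ()
  next-≢ (suc zero) ()
  next-≢ (suc (suc zero)) ()

  next²-≢ : ∀ t → next Γ (next Γ t) ≢ t
  next²-≢ zero ()
  next²-≢ (suc zero) ()
  next²-≢ (suc (suc zero)) ()

  next-trichotomy : ∀ i j → j ≡ i ⊎ j ≡ next Γ i ⊎ i ≡ next Γ j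
  next-trichotomy zero zero = inj₁ refl
  next-trichotomy zero (suc zero) = inj₂ (inj₁ refl)
  next-trichotomy zero (suc (suc zero)) = inj₂ (inj₂ refl)
  next-trichotomy (suc zero) zero = inj₂ (inj₂ refl)
  next-trichotomy (suc zero) (suc zero) = inj₁ refl
  next-trichotomy (suc zero) (suc (suc zero)) = inj₂ (inj₁ refl)
  next-trichotomy (suc (suc zero)) zero = inj₂ (inj₁ refl)
  next-trichotomy (suc (suc zero)) (suc zero) = inj₂ (inj₂ refl)
  next-trichotomy (suc (suc zero)) (suc (suc zero)) = inj₁ refl

  *⇒Adj : ∀ {x y} → ty y ≡ next Γ (ty x) → _*_ Γ x y → Adj Γ x y
  *⇒Adj {x} y≡next-x (inj₁ refl) = contradiction (sym y≡next-x) (next-≢ (ty x))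
  *⇒Adj y≡next-x (inj₂ (inj₁ x→y)) = x→y
  *⇒Adj {x} y≡next-x (inj₂ (inj₂ (x≡next-y , _))) =
    contradiction (sym (trans x≡next-y (cong (next Γ) y≡next-x))) (next²-≢ (ty x))

  Path² : Elem Γ → Elem Γ → Set
  Path² x y = ∃[ z ] (Adj Γ x z × Adj Γ z y)

  Path²⇒notOn : ∀ {x y} → Path² x y → ¬ I Γ (pt x) (ln y)
  Path²⇒notOn {x} (z , (_ , x∧z , x≢z) , (_ , z∧y , _)) x∈y =
    x≢z (to (z∧y (pt x)) (proj₂ (from (x∧z (pt x)) refl) , x∈y))

  module _ (LS : IsLinearSpace Γ) (TH : IsThick Γ) where
    open IsLinearSpace LS
    open LinearSpaceProperties Γ LS

    notOn⇒Path² : ∀ {x y} → ty x ≡ next Γ (ty y) → ¬ I Γ (pt x) (ln y) → Path² x y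
    notOn⇒Path² {elem p L p∈L i} {elem p' L' _ j} i≡next-j p∉L'
      with ∃-pointOn-notOn-≢ TH (on-notOn⇒lines≢ p∈L p∉L') p'
    ... | q , q∈L' , q∉L , q≢p'
      with join p q (notOn-on⇒points≢ p∉L' q∈L')
    ... | M , p∈M , q∈M =
      elem q M q∈M (next Γ i)
        , (refl , distinctLines-meetExactly p∈L p∈M (≢-sym (on-notOn⇒lines≢ q∈M q∉L))
                , notOn-on⇒points≢ p∉L' q∈L')
        , (j≡next²-i , distinctLines-meetExactly q∈M q∈L' (on-notOn⇒lines≢ p∈M p∉L') , q≢p')
      where
      j≡next²-i : j ≡ next Γ (next Γ i)
      j≡next²-i = sym (trans (cong (λ t → next Γ (next Γ t)) i≡next-j) (next³ j))

    I⇔¬Path² : ∀ {x y} → ty x ≡ next Γ (ty y) → I Γ (pt x) (ln y) ⇔ (¬ Path² x y)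
    I⇔¬Path² {x} {y} x≡next-y = mk⇔
      (λ x∈y path → Path²⇒notOn {x} {y} path x∈y)
      (λ ¬path → decidable-stable (I? (pt x) (ln y))
                                  (λ x∉y → ¬path (notOn⇒Path² {x} {y} x≡next-y x∉y)))

module TriangleComplexAutomorphism (Γ : Geometry) (LS : IsLinearSpace Γ) (TH : IsThick Γ)
  (φ : Elem Γ → Elem Γ) (φ-aut : IsΔAutomorphism Γ φ) where
  open IsΔAutomorphism φ-aut
  open LinearSpaceProperties Γ LS
  open TriangleComplex Γ

  φ-preimage : ∀ e → ∃[ z ] φ z ≡ e
  φ-preimage e = let (z , z≡⇒φz≡e) = proj₂ bij e in z , z≡⇒φz≡e refl

  φ-next : ∀ {x y} → ty y ≡ next Γ (ty x) → ty (φ y) ≡ next Γ (ty (φ x))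
  φ-next {x} {y} = subst₂ (λ a b → b ≡ next Γ a) (sym (typePres x)) (sym (typePres y))

  φ⁻¹-next : ∀ {x y} → ty (φ y) ≡ next Γ (ty (φ x)) → ty y ≡ next Γ (ty x)
  φ⁻¹-next {x} {y} = subst₂ (λ a b → b ≡ next Γ a) (typePres x) (typePres y)

  Adj-φ : ∀ {x y} → Adj Γ x y ⇔ Adj Γ (φ x) (φ y)
  Adj-φ {x} {y} = mk⇔
    (λ x→y → *⇒Adj (φ-next (proj₁ x→y)) (to (incPres x y) (inj₂ (inj₁ x→y))))
    (λ φx→φy → *⇒Adj (φ⁻¹-next (proj₁ φx→φy)) (from (incPres x y) (inj₂ (inj₁ φx→φy))))

  Path²-φ : ∀ {x y} → Path² x y ⇔ Path² (φ x) (φ y)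
  Path²-φ {x} {y} = mk⇔
    (λ (z , x→z , z→y) → φ z , to Adj-φ x→z , to Adj-φ z→y)
    λ (w , φx→w , w→φy) → let (z , φz≡w) = φ-preimage w in
      z , from Adj-φ (subst (Adj Γ (φ x)) (sym φz≡w) φx→w)
        , from Adj-φ (subst (λ v → Adj Γ v (φ y)) (sym φz≡w) w→φy)

  I-φ : ∀ {x y} → ty x ≡ next Γ (ty y) → I Γ (pt x) (ln y) ⇔ I Γ (pt (φ x)) (ln (φ y))
  I-φ {x} {y} x≡next-y =
    ⇔.trans (I⇔¬Path² LS TH {x} {y} x≡next-y)
            (⇔.trans (¬-cong-⇔ Path²-φ)
                     (⇔.sym (I⇔¬Path² LS TH {φ x} {φ y} (φ-next x≡next-y))))

  ∃-ptPreimage : ∀ w t → ∃[ z ] (ty z ≡ t × pt (φ z) ≡ w)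
  ∃-ptPreimage w t =
    let (L , w∈L) = ∃-lineThrough w
        (z , φz≡e) = φ-preimage (elem w L w∈L t)
    in z , trans (sym (typePres z)) (cong ty φz≡e) , cong pt φz≡e

  ∃-lnPreimage : ∀ M t → ∃[ z ] (ty z ≡ t × ln (φ z) ≡ M)
  ∃-lnPreimage M t =
    let (p , p∈M) = ∃-pointOn M
        (z , φz≡e) = φ-preimage (elem p M p∈M t)
    in z , trans (sym (typePres z)) (cong ty φz≡e) , cong ln φz≡e

  ∃-ptPreimage-on : ∀ {y w} → I Γ w (ln (φ y)) →
                    ∃[ z ] (ty z ≡ next Γ (ty y) × pt (φ z) ≡ w × I Γ (pt z) (ln y))
  ∃-ptPreimage-on {y} {w} w∈φy =
    let (z , z≡next-y , φz≡w) = ∃-ptPreimage w (next Γ (ty y))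
    in z , z≡next-y , φz≡w
         , from (I-φ z≡next-y) (subst (λ v → I Γ v (ln (φ y))) (sym φz≡w) w∈φy)

  ∃-lnPreimage-through : ∀ {x M} → I Γ (pt (φ x)) M →
                         ∃[ z ] (ty x ≡ next Γ (ty z) × ln (φ z) ≡ M × I Γ (pt x) (ln z))
  ∃-lnPreimage-through {x} {M} φx∈M =
    let (z , z≡next²-x , φz≡M) = ∃-lnPreimage M (next Γ (next Γ (ty x)))
        x≡next-z = trans (sym (next³ (ty x))) (cong (next Γ) (sym z≡next²-x))
    in z , x≡next-z , φz≡M
         , from (I-φ x≡next-z) (subst (I Γ (pt (φ x))) (sym φz≡M) φx∈M)

  ln-φ-sameType : ∀ {y y'} → ty y ≡ ty y' → ln y ≡ ln y' → ln (φ y) ≡ ln (φ y')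
  ln-φ-sameType {y} {y'} ty≡ ln≡ = points⊆⇒line≡ λ w w∈φy →
    let (z , z≡next-y , φz≡w , z∈y) = ∃-ptPreimage-on {y} w∈φy
        z≡next-y' = trans z≡next-y (cong (next Γ) ty≡)
    in subst (λ v → I Γ v (ln (φ y'))) φz≡w
             (to (I-φ z≡next-y') (subst (I Γ (pt z)) ln≡ z∈y))

  pt-φ-sameType : ∀ {x x'} → ty x ≡ ty x' → pt x ≡ pt x' → pt (φ x) ≡ pt (φ x')
  pt-φ-sameType {x} {x'} ty≡ pt≡ = lines⊆⇒point≡ λ M φx∈M →
    let (z , x≡next-z , φz≡M , x∈z) = ∃-lnPreimage-through {x} φx∈M
        x'≡next-z = trans (sym ty≡) x≡next-z
    in subst (I Γ (pt (φ x'))) φz≡M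
             (to (I-φ x'≡next-z) (subst (λ v → I Γ v (ln z)) pt≡ x∈z))

  ln-φ-nextType : ∀ {y y'} → ty y' ≡ next Γ (ty y) → ln y ≡ ln y' → ln (φ y) ≡ ln (φ y')
  ln-φ-nextType {y} {y'} y'≡next-y ln≡ = points⊆⇒line≡ λ w w∈φy →
    let (z , z≡next-y , φz≡w , z∈y) = ∃-ptPreimage-on {y} w∈φy
        e = elem (pt z) (ln y') (subst (I Γ (pt z)) ln≡ z∈y) (ty y')
        φe≡φz : pt (φ e) ≡ pt (φ z)
        φe≡φz = pt-φ-sameType (trans y'≡next-y (sym z≡next-y)) refl
    in subst₂ (I Γ) (trans φe≡φz φz≡w) (ln-φ-sameType {e} {y'} refl refl) (isI (φ e))

  ln-φ : ∀ {y y'} → ln y ≡ ln y' → ln (φ y) ≡ ln (φ y')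
  ln-φ {y} {y'} ln≡ with next-trichotomy (ty y) (ty y')
  ... | inj₁ y'≡y = ln-φ-sameType (sym y'≡y) ln≡
  ... | inj₂ (inj₁ y'≡next-y) = ln-φ-nextType y'≡next-y ln≡
  ... | inj₂ (inj₂ y≡next-y') = sym (ln-φ-nextType y≡next-y' (sym ln≡))

  pt-φ : ∀ {x x'} → pt x ≡ pt x' → pt (φ x) ≡ pt (φ x')
  pt-φ {x} {x'} pt≡ = lines⊆⇒point≡ λ M φx∈M →
    let (z , _ , φz≡M , x∈z) = ∃-lnPreimage-through {x} φx∈M
        e = elem (pt x') (ln z) (subst (λ v → I Γ v (ln z)) pt≡ x∈z) (ty x')
    in subst₂ (I Γ) (pt-φ-sameType {e} {x'} refl refl) (trans (ln-φ {e} {z} refl) φz≡M)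
              (isI (φ e))

  fP : Point Γ → Point Γ
  fP p = let (L , p∈L) = ∃-lineThrough p in pt (φ (elem p L p∈L zero))

  fL : Line Γ → Line Γ
  fL L = let (p , p∈L) = ∃-pointOn L in ln (φ (elem p L p∈L zero))

  fP-pt : ∀ x → fP (pt x) ≡ pt (φ x)
  fP-pt x = pt-φ refl

  fL-ln : ∀ y → fL (ln y) ≡ ln (φ y)
  fL-ln y = ln-φ refl

  I⇔I-fP-fL : ∀ p L → I Γ p L ⇔ I Γ (fP p) (fL L)
  I⇔I-fP-fL p L = mk⇔
    (λ p∈L → let x = elem p L p∈L zero in
      subst₂ (I Γ) (sym (fP-pt x)) (sym (fL-ln x)) (isI (φ x)))
    (λ fp∈fL → let (M , p∈M) = ∃-lineThrough p
                   (q , q∈L) = ∃-pointOn L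
                   x = elem p M p∈M (suc zero)
                   y = elem q L q∈L zero
               in from (I-φ {x} {y} refl) (subst₂ (I Γ) (fP-pt x) (fL-ln y) fp∈fL))

  fP-fL-isAutomorphism : IsAutomorphism Γ fP fL
  fP-fL-isAutomorphism = record
    { bijP = fP-injective , strictlySurjective⇒surjective fP-strictlySurjective
    ; bijL = fL-injective , strictlySurjective⇒surjective fL-strictlySurjective
    ; pres = I⇔I-fP-fL
    }
    where
    fP-injective : Injective _≡_ _≡_ fP
    fP-injective {p} {p'} fp≡fp' = lines⊆⇒point≡ λ M p∈M →
      from (I⇔I-fP-fL p' M) (subst (λ v → I Γ v (fL M)) fp≡fp' (to (I⇔I-fP-fL p M) p∈M))

    fL-injective : Injective _≡_ _≡_ fL
    fL-injective {L} {L'} fL≡fL' = points⊆⇒line≡ λ w w∈L →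
      from (I⇔I-fP-fL w L') (subst (I Γ (fP w)) fL≡fL' (to (I⇔I-fP-fL w L) w∈L))

    fP-strictlySurjective : StrictlySurjective _≡_ fP
    fP-strictlySurjective w =
      let (z , _ , φz≡w) = ∃-ptPreimage w zero in pt z , trans (fP-pt z) φz≡w

    fL-strictlySurjective : StrictlySurjective _≡_ fL
    fL-strictlySurjective M =
      let (z , _ , φz≡M) = ∃-lnPreimage M zero in ln z , trans (fL-ln z) φz≡M

proposition3p9 : (Γ : Geometry) → IsLinearSpace Γ → IsThick Γ → FlagTransitive Γ →
    (φ : Elem Γ → Elem Γ) → IsΔAutomorphism Γ φ →
    ∃[ fP ] ∃[ fL ] (IsAutomorphism Γ fP fL ×
      (∀ (p : Point Γ) (L : Line Γ) (h : I Γ p L) (i : Fin 3) →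
        pt (φ (elem p L h i)) ≡ fP p × ln (φ (elem p L h i)) ≡ fL L × ty (φ (elem p L h i)) ≡ i))
proposition3p9 Γ LS TH _ φ φ-aut =
  fP , fL , fP-fL-isAutomorphism ,
  λ p L p∈L i → let x = elem p L p∈L i in sym (fP-pt x) , sym (fL-ln x) , typePres x
  where
  open TriangleComplexAutomorphism Γ LS TH φ φ-aut
  open IsΔAutomorphism φ-aut using (typePres)
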